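{- Let $a$ and $b$ be positive integers such that $\gcd(a,b)=1$. Let $p(z)=a_Dz^D+\dots+a_1z\in \mathbb{Z}[z]$ (with zero constant term) satisfy $D\ge 2$, $a_D>0$ and $a_1\neq 0$. Then the equation $ax+by=p(z)$ is 2-Ramsey.
   Context: For $k\in\mathbb{Z}^+$, an equation in the variables $x,y,z$ is called $k$-Ramsey if every colouring of the positive integers $\mathbb{Z}^+$ with $k$ colours admits infinitely many monochromatic solutions $(x,y,z)\in(\mathbb{Z}^+)^3$, i.e. solutions with $x,y,z$ all receiving the same colour. -}

module Defs where

open import Data.Nat as ℕ using (ℕ; zero; suc; _<_; _≤_)
open import Data.Integer as ℤ using (ℤ; +_; _+_; _*_)
open import Data.Fin using (Fin)
open import Data.Product using (Σ; _×_; ∃-syntax)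

-- An integer polynomial with zero constant term, given by its coefficient
-- list [a₁, a₂, …, a_D] (the i-th entry, from 1, is the coefficient of z^i).
-- eval (a₁ ∷ a₂ ∷ … ∷ a_D ∷ []) z = a₁ z + a₂ z² + … + a_D z^D  (Horner form).
open import Data.List using (List; []; _∷_)

eval : List ℤ → ℤ → ℤ
eval []       z = + 0
eval (c ∷ cs) z = z * (c + eval cs z)

-- A k-colouring of ℕ (only its values on positive integers matter).
Colouring : ℕ → Set
Colouring k = ℕ → Fin k

IsSolution : ℕ → ℕ → List ℤ → ℕ → ℕ → ℕ → Set
IsSolution a b cs x y z =
  (0 < x) × (0 < y) × (0 < z) ×
  (+ a * + x + + b * + y ≡ eval cs (+ z))
  where open import Relation.Binary.PropositionalEquality using (_≡_)

-- k-Ramsey: every k-colouring has infinitely many monochromatic solutions,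
-- expressed as: for every bound N there is a monochromatic solution with
-- x + y + z > N (a set of triples of positive integers is infinite iff unbounded).
KRamsey : ℕ → ℕ → ℕ → List ℤ → Set
KRamsey k a b cs =
  (c : Colouring k) → (N : ℕ) →
  ∃[ x ] ∃[ y ] ∃[ z ]
    IsSolution a b cs x y z × (N < x ℕ.+ y ℕ.+ z) ×
    (c x ≡ c y) × (c y ≡ c z)
  where open import Relation.Binary.PropositionalEquality using (_≡_)

-- Write p(z) = z r(z) with r(z) = a₁ + a₂ z + … + a_D z^(D-1); for large z, r is
-- positive, increasing, unbounded and slowly varying (r(v)/r(u) → 1 as v/u → 1).
-- Whenever p(Z) = a b Q, each split Q = X + Y gives the solution (b X, a Y, Z), so it
-- suffices to find a split whose two parts b X and a Y have the colour of Z.  On the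
-- grid G j = H j, either the colouring is constant for a long stretch, which yields a
-- diagonal solution (w, w, Z) with (a + b) w = p(Z), or it changes colour.  After a
-- change one finds three points Z₂ < Z < Z₁ coloured β, ρ, β whose values a b q₂,
-- a b Q, a b q₁ satisfy b K ≤ q₂ < Q = (a + b) K < q₁ < Q + b K (slow variation makes
-- them that close); a rotation argument on the window of possible X then forces a
-- monochromatic split of one of the three targets.
module Submission where

open import Defs
open import Data.Empty using (⊥-elim)
open import Data.Fin using (Fin; zero; suc; _≟_)
open import Data.Integer as ℤ using (ℤ; +_; -[1+_]; +<+)
  renaming (_+_ to _+ℤ_; _*_ to _*ℤ_; _<_ to _<ℤ_)
import Data.Integer.Properties as ℤ
open import Data.List using (List; []; _∷_; length; last)
open import Data.Maybe using (just)
open import Data.Nat hiding (_≟_)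
open import Data.Nat.DivMod
  using (_%_; %-distribˡ-+; m%n%n≡m%n; m%n<n; m<n⇒m%n≡m; [m+n]%n≡m%n; [m+kn]%n≡m%n)
open import Data.Nat.GCD using (gcd)
open import Data.Nat.Properties hiding (_≟_)
open import Data.Nat.Tactic.RingSolver using (solve-∀)
open import Data.Product using (Σ; _×_; _,_; proj₁; proj₂; ∃-syntax)
open import Data.Sum using (_⊎_; inj₁; inj₂; [_,_]′; map₂)
open import Relation.Binary.PropositionalEquality
  using (_≡_; _≢_; refl; sym; trans; cong; cong₂; subst; subst₂; module ≡-Reasoning)
open import Relation.Nullary using (¬_; Dec; yes; no)

x≢z∧y≢z⇒x≡y : ∀ {x y z : Fin 2} → x ≢ z → y ≢ z → x ≡ y
x≢z∧y≢z⇒x≡y {zero}     {zero}     _   _   = refl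
x≢z∧y≢z⇒x≡y {suc zero} {suc zero} _   _   = refl
x≢z∧y≢z⇒x≡y {zero}     {suc zero} {zero}     x≢z _   = ⊥-elim (x≢z refl)
x≢z∧y≢z⇒x≡y {zero}     {suc zero} {suc zero} _   y≢z = ⊥-elim (y≢z refl)
x≢z∧y≢z⇒x≡y {suc zero} {zero}     {zero}     _   y≢z = ⊥-elim (y≢z refl)
x≢z∧y≢z⇒x≡y {suc zero} {zero}     {suc zero} x≢z _   = ⊥-elim (x≢z refl)

[m%n+k]%n≡[m+k]%n : ∀ m k n .{{_ : NonZero n}} → (m % n + k) % n ≡ (m + k) % n
[m%n+k]%n≡[m+k]%n m k n = begin
  (m % n + k) % n           ≡⟨ %-distribˡ-+ (m % n) k n ⟩
  (m % n % n + k % n) % n   ≡⟨ cong (λ x → (x + k % n) % n) (m%n%n≡m%n m n) ⟩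
  (m % n + k % n) % n       ≡⟨ %-distribˡ-+ m k n ⟨
  (m + k) % n               ∎
  where open ≡-Reasoning

iterate-rotation : ∀ {A : Set} (Inv : ℕ → Set) m s .{{_ : NonZero m}} →
                   (∀ o → o < m → Inv o → A ⊎ Inv ((o + s) % m)) →
                   ∀ o → Inv (o % m) → ∀ k → A ⊎ Inv ((o + k * s) % m)
iterate-rotation Inv m s step o inv zero = inj₂ (subst (λ x → Inv (x % m)) (sym (+-identityʳ o)) inv)
iterate-rotation Inv m s step o inv (suc k) with iterate-rotation Inv m s step o inv k
... | inj₁ a    = inj₁ a
... | inj₂ invₖ = map₂ (subst Inv (trans ([m%n+k]%n≡[m+k]%n (o + k * s) s m) (cong (_% m) (e o k s))))
                       (step _ (m%n<n (o + k * s) m) invₖ)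
  where
  e : ∀ o k s → o + k * s + s ≡ o + suc k * s
  e = solve-∀

ConstantUpTo : (ℕ → Fin 2) → ℕ → Set
ConstantUpTo g i = ∀ k → k ≤ i → g k ≡ g 0

run-until : ∀ (g : ℕ → Fin 2) {Q : ℕ → Set} → (∀ i → Dec (Q i)) → ∀ n → Q n →
            (∃[ i ] (ConstantUpTo g i × Q i)) ⊎ (∃[ i ] (ConstantUpTo g i × ¬ Q i × g (suc i) ≢ g 0))
run-until g {Q} Q? n Qn = go 0 n refl (λ { zero _ → refl })
  where
  go : ∀ i d → i + d ≡ n → ConstantUpTo g i →
       (∃[ i ] (ConstantUpTo g i × Q i)) ⊎ (∃[ i ] (ConstantUpTo g i × ¬ Q i × g (suc i) ≢ g 0))
  go i d i+d≡n run with Q? i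
  ... | yes Qi = inj₁ (i , run , Qi)
  go i zero    i+d≡n run | no ¬Qi = ⊥-elim (¬Qi (subst Q (trans (sym i+d≡n) (+-identityʳ i)) Qn))
  go i (suc d) i+d≡n run | no ¬Qi with g (suc i) ≟ g 0
  ... | no end = inj₂ (i , run , ¬Qi , end)
  ... | yes same = go (suc i) d (trans (sym (+-suc i d)) i+d≡n) run′
    where
    run′ : ConstantUpTo g (suc i)
    run′ k k≤si with m≤n⇒m<n∨m≡n k≤si
    ... | inj₁ k<si = run k (≤-pred k<si)
    ... | inj₂ refl = same

bracket : ∀ (F : ℕ → ℕ) {y} n → F 0 ≤ y → y < F n → ∃[ k ] (k < n × F k ≤ y × y < F (suc k))
bracket F zero    F0≤y y<F0 = ⊥-elim (<⇒≱ y<F0 F0≤y)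
bracket F {y} (suc n) F0≤y y<Fsn with y <? F n
... | yes y<Fn = let k , k<n , below = bracket F n F0≤y y<Fn in k , m≤n⇒m≤1+n k<n , below
... | no y≮Fn  = n , ≤-refl , ≮⇒≥ y≮Fn , y<Fsn

Eventually : (ℕ → Set) → Set
Eventually Q = ∃[ S ] (∀ z → S ≤ z → Q z)

eventually-× : ∀ {Q R : ℕ → Set} → Eventually Q → Eventually R → Eventually (λ z → Q z × R z)
eventually-× (S , p) (T , q) = S ⊔ T , λ z h → p z (m⊔n≤o⇒m≤o S T h) , q z (m⊔n≤o⇒n≤o S T h)

eventually-mono : ∀ {Q R : ℕ → Set} → (∀ {z} → Q z → R z) → Eventually Q → Eventually R
eventually-mono f (S , p) = S , λ z h → f (p z h)

Close : ℕ → ℕ → ℕ → Set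
Close K u v = K * v ≤ suc K * u

Unbounded : (ℕ → ℕ) → Set
Unbounded f = ∀ C → Eventually (λ z → C ≤ f z)

EventuallyMonotone : (ℕ → ℕ) → Set
EventuallyMonotone f = Eventually (λ u → ∀ v → u ≤ v → f u ≤ f v)

SlowlyVarying : (ℕ → ℕ) → Set
SlowlyVarying f =
  ∀ m → ∃[ K ] Eventually (λ u → ∀ v → u ≤ v → Close K u v → Close m (f u) (f v))

record Regular (f : ℕ → ℕ) : Set where
  field
    positive      : Eventually (λ z → 1 ≤ f z)
    monotone      : EventuallyMonotone f
    slowlyVarying : SlowlyVarying f

open Regular

Close-refl : ∀ m n → Close m n n
Close-refl m n = *-monoˡ-≤ n (n≤1+n m)

Close-antimono : ∀ {K′ K u v} → K′ ≤ K → u ≤ v → Close K u v → Close K′ u v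
Close-antimono {K′} {K} {u} {v} K′≤K u≤v Kv≤sKu =
  subst₂ _≤_ (sym (split K′)) (sym (+-comm u (K′ * u)))
    (+-monoʳ-≤ (K′ * u) (≤-trans (*-monoˡ-≤ d K′≤K) Kd≤u))
  where
  d : ℕ
  d = v ∸ u
  split : ∀ k → k * v ≡ k * u + k * d
  split k = trans (cong (k *_) (sym (m+[n∸m]≡n u≤v))) (*-distribˡ-+ k u d)
  Kd≤u : K * d ≤ u
  Kd≤u = +-cancelˡ-≤ (K * u) _ _ (subst₂ _≤_ (split K) (+-comm u (K * u)) Kv≤sKu)

Close-+ : ∀ {m x y} k → Close m x y → Close m (k + x) (k + y)
Close-+ {m} {x} {y} k close = subst₂ _≤_ (sym (*-distribˡ-+ m k y)) (sym (*-distribˡ-+ (suc m) k x))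
  (+-mono-≤ (*-monoˡ-≤ k (n≤1+n m)) close)

-- Halving the precision absorbs a subtracted constant that is small compared to x.
Close-∸ : ∀ {m x y} j → Close (suc (2 * m)) x y → 2 * j ≤ x → x ≤ y → Close m (x ∸ j) (y ∸ j)
Close-∸ {m} {x} {y} j close 2j≤x x≤y = *-cancelˡ-≤ (suc (2 * m)) goal
  where
  x′ y′ : ℕ
  x′ = x ∸ j
  y′ = y ∸ j
  j≤x : j ≤ x
  j≤x = ≤-trans (m≤m+n j (j + 0)) 2j≤x
  x≡ : x ≡ j + x′
  x≡ = sym (m+[n∸m]≡n j≤x)
  y≡ : y ≡ j + y′
  y≡ = sym (m+[n∸m]≡n (≤-trans j≤x x≤y))
  j≤x′ : j ≤ x′
  j≤x′ = +-cancelˡ-≤ j _ _ (subst₂ _≤_ (cong (λ w → j + w) (+-identityʳ j)) x≡ 2j≤x)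
  lhs : ∀ m j y′ → suc (2 * m) * (j + y′) ≡ suc (2 * m) * j + suc (2 * m) * y′
  lhs = solve-∀
  rhs : ∀ m j x′ → suc (suc (2 * m)) * (j + x′) ≡ suc (2 * m) * j + (j + suc (suc (2 * m)) * x′)
  rhs = solve-∀
  y′-bound : suc (2 * m) * y′ ≤ j + suc (suc (2 * m)) * x′
  y′-bound = +-cancelˡ-≤ (suc (2 * m) * j) _ _
    (subst₂ _≤_ (trans (cong (suc (2 * m) *_) y≡) (lhs m j y′))
                (trans (cong (suc (suc (2 * m)) *_) x≡) (rhs m j x′)) close)
  e₁ : ∀ m y′ → suc (2 * m) * (m * y′) ≡ m * (suc (2 * m) * y′)
  e₁ = solve-∀
  e₂ : ∀ m x′ → m * (x′ + suc (suc (2 * m)) * x′) + x′ ≡ suc (2 * m) * (suc m * x′)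
  e₂ = solve-∀
  goal : suc (2 * m) * (m * y′) ≤ suc (2 * m) * (suc m * x′)
  goal = subst₂ _≤_ (sym (e₁ m y′)) (e₂ m x′)
    (≤-trans (*-monoʳ-≤ m (≤-trans y′-bound (+-monoˡ-≤ _ j≤x′))) (m≤m+n _ _))

-- (1 + 1/(2m + 1))² ≤ 1 + 1/m.
Close-* : ∀ {m u v u′ v′} → Close (suc (2 * m)) u v → Close (suc (2 * m)) u′ v′ →
          Close m (u * u′) (v * v′)
Close-* {m} {u} {v} {u′} {v′} close close′ =
  *-cancelˡ-≤ (suc (2 * m) * suc (2 * m)) (subst₂ _≤_ (sym (e₃ m (v * v′))) (e₄ m (u * u′))
    (≤-trans (*-monoʳ-≤ m (subst₂ _≤_ (e₁ m v v′) (e₂ m u u′) (*-mono-≤ close close′)))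
             (m≤m+n _ _)))
  where
  e₁ : ∀ m v v′ → (suc (2 * m) * v) * (suc (2 * m) * v′) ≡ (suc (2 * m) * suc (2 * m)) * (v * v′)
  e₁ = solve-∀
  e₂ : ∀ m u u′ →
       (suc (suc (2 * m)) * u) * (suc (suc (2 * m)) * u′)
       ≡ (suc (suc (2 * m)) * suc (suc (2 * m))) * (u * u′)
  e₂ = solve-∀
  e₃ : ∀ m A → (suc (2 * m) * suc (2 * m)) * (m * A) ≡ m * ((suc (2 * m) * suc (2 * m)) * A)
  e₃ = solve-∀
  e₄ : ∀ m B → m * ((suc (suc (2 * m)) * suc (suc (2 * m))) * B) + (B + m * B)
              ≡ (suc (2 * m) * suc (2 * m)) * (suc m * B)
  e₄ = solve-∀

Close-*-cancelˡ : ∀ {K u v} n .{{_ : NonZero n}} → Close K (n * u) (n * v) → Close K u v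
Close-*-cancelˡ {K} {u} {v} n close = *-cancelˡ-≤ n (subst₂ _≤_ (e K n v) (e (suc K) n u) close)
  where
  e : ∀ K n v → K * (n * v) ≡ n * (K * v)
  e = solve-∀

const-regular : ∀ n → Regular (λ _ → suc n)
const-regular n = record
  { positive      = 0 , λ _ _ → s≤s z≤n
  ; monotone      = 0 , λ _ _ _ _ → ≤-refl
  ; slowlyVarying = λ m → 0 , 0 , λ _ _ _ _ _ → Close-refl m (suc n)
  }

+-regular : ∀ k {h} → Regular h → Regular (λ z → k + h z)
+-regular k {h} R = record
  { positive      = eventually-mono (λ {z} 1≤h → ≤-trans 1≤h (m≤n+m (h z) k)) (positive R)
  ; monotone      = eventually-mono (λ mono v u≤v → +-monoʳ-≤ k (mono v u≤v)) (monotone R)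
  ; slowlyVarying = λ m → let K , E = slowlyVarying R m in
      K , eventually-mono (λ slow v u≤v close → Close-+ {m = m} k (slow v u≤v close)) E
  }

+-unbounded : ∀ k {h} → Unbounded h → Unbounded (λ z → k + h z)
+-unbounded k {h} U C = eventually-mono (λ {z} C≤h → ≤-trans C≤h (m≤n+m (h z) k)) (U C)

∸-unbounded : ∀ j {h} → Unbounded h → Unbounded (λ z → h z ∸ j)
∸-unbounded j {h} U C =
  eventually-mono (λ {z} big → subst (_≤ h z ∸ j) (m+n∸n≡m C j) (∸-monoˡ-≤ j big)) (U (C + j))

∸-regular : ∀ j {h} → Unbounded h → Regular h → Regular (λ z → h z ∸ j)
∸-regular j {h} U R = record
  { positive      = ∸-unbounded j U 1
  ; monotone      = eventually-mono (λ mono v u≤v → ∸-monoˡ-≤ j (mono v u≤v)) (monotone R)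
  ; slowlyVarying = λ m → let K , E = slowlyVarying R (suc (2 * m)) in
      K , eventually-mono (λ (slow , big , mono) v u≤v close →
                              Close-∸ {m = m} j (slow v u≤v close) big (mono v u≤v))
                          (eventually-× E (eventually-× (U (2 * j)) (monotone R)))
  }

*-regular : ∀ {g} → Regular g → Regular (λ z → z * g z)
*-regular {g} R = record
  { positive      = eventually-mono (λ (1≤z , 1≤g) → *-mono-≤ 1≤z 1≤g)
                                    (eventually-× (1 , λ _ 1≤z → 1≤z) (positive R))
  ; monotone      = eventually-mono (λ mono v u≤v → *-mono-≤ u≤v (mono v u≤v)) (monotone R)
  ; slowlyVarying = λ m → let K , E = slowlyVarying R (suc (2 * m)) in
      K ⊔ suc (2 * m) , eventually-mono (λ {u} slow v u≤v close →
        Close-* {m} {u} {v} {g u} {g v} (Close-antimono (m≤n⊔m K _) u≤v close)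
                (slow v u≤v (Close-antimono (m≤m⊔n K _) u≤v close))) E
  }

*-unbounded : ∀ {g} → Regular g → Unbounded (λ z → z * g z)
*-unbounded {g} R C =
  eventually-mono (λ {z} (C≤z , 1≤g) → ≤-trans C≤z (m≤m*n z (g z) {{>-nonZero 1≤g}}))
                  (eventually-× (C , λ _ C≤z → C≤z) (positive R))

EventuallyRegularUnbounded : (ℕ → ℤ) → Set
EventuallyRegularUnbounded f =
  Σ (ℕ → ℕ) λ g → Regular g × Unbounded g × Eventually (λ z → f z ≡ + g z)

+ℤ-eventuallyRegularUnbounded : ∀ c {f} → EventuallyRegularUnbounded f →
                                EventuallyRegularUnbounded (λ z → c +ℤ f z)
+ℤ-eventuallyRegularUnbounded (+ k) (g , R , U , E) =
  (λ z → k + g z) , +-regular k R , +-unbounded k U , eventually-mono (cong ((+ k) +ℤ_)) E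
+ℤ-eventuallyRegularUnbounded -[1+ k ] (g , R , U , E) =
  (λ z → g z ∸ suc k) , ∸-regular (suc k) U R , ∸-unbounded (suc k) U ,
  eventually-mono (λ (f≡g , big) → trans (cong (-[1+ k ] +ℤ_) f≡g) (ℤ.⊖-≥ big))
                  (eventually-× E (U (suc k)))

*ℤ-eventuallyRegularUnbounded : ∀ {f} → EventuallyRegularUnbounded f →
                                EventuallyRegularUnbounded (λ z → + z *ℤ f z)
*ℤ-eventuallyRegularUnbounded (g , R , U , E) =
  (λ z → z * g z) , *-regular R , *-unbounded R ,
  eventually-mono (λ {z} f≡g → trans (cong ((+ z) *ℤ_) f≡g) (sym (ℤ.pos-* z (g z)))) E

eval-eventuallyRegularUnbounded : ∀ cs {ℓ} → last cs ≡ just ℓ → + 0 <ℤ ℓ →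
                         EventuallyRegularUnbounded (λ z → eval cs (+ z))
eval-eventuallyRegularUnbounded (+ zero ∷ [])   refl (+<+ ())
eval-eventuallyRegularUnbounded (-[1+ _ ] ∷ []) refl ()
eval-eventuallyRegularUnbounded (+ suc k ∷ [])  refl _ =
  (λ z → z * suc k) , *-regular (const-regular k) , *-unbounded (const-regular k) ,
  (0 , λ z _ → trans (cong ((+ z) *ℤ_) (ℤ.+-identityʳ (+ suc k))) (sym (ℤ.pos-* z (suc k))))
eval-eventuallyRegularUnbounded (c ∷ d ∷ ds) last≡ℓ 0<ℓ =
  *ℤ-eventuallyRegularUnbounded
    (+ℤ-eventuallyRegularUnbounded c (eval-eventuallyRegularUnbounded (d ∷ ds) last≡ℓ 0<ℓ))

-- For P z = a b Q, a split X + Y = Q gives the solution (b X, a Y, z) of a x + b y = P z.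
MonoSplit : Colouring 2 → ℕ → ℕ → ℕ → Fin 2 → Set
MonoSplit c a b Q γ = ∃[ X ] ∃[ Y ] (1 ≤ X × 1 ≤ Y × X + Y ≡ Q × c (b * X) ≡ γ × c (a * Y) ≡ γ)

ThreeTargets : Colouring 2 → ℕ → ℕ → ℕ → ℕ → ℕ → Fin 2 → Fin 2 → Set
ThreeTargets c a b q₂ Q q₁ β ρ = MonoSplit c a b q₂ β ⊎ MonoSplit c a b Q ρ ⊎ MonoSplit c a b q₁ β

module Rotation (c : Colouring 2) (a b A B q₂ q₁ e t s₁ f : ℕ) {β ρ : Fin 2} (β≢ρ : β ≢ ρ)
                (bA≡aB : b * A ≡ a * B) (A≡ : suc t + e ≡ A) (B≡ : s₁ + suc f ≡ B)
                (q₂≡ : e + B ≡ q₂) (q₁≡ : A + B + s₁ ≡ q₁) where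

  Outcome : Set
  Outcome = ThreeTargets c a b q₂ (A + B) q₁ β ρ

  ≢β⇒≡ρ : ∀ {x} → x ≢ β → x ≡ ρ
  ≢β⇒≡ρ x≢β = x≢z∧y≢z⇒x≡y x≢β (λ ρ≡β → β≢ρ (sym ρ≡β))

  ≢ρ⇒≡β : ∀ {x} → x ≢ ρ → x ≡ β
  ≢ρ⇒≡β x≢ρ = x≢z∧y≢z⇒x≡y x≢ρ β≢ρ

  m : ℕ
  m = s₁ + suc t

  instance
    m≢0 : NonZero m
    m≢0 = >-nonZero (≤-trans (s≤s z≤n) (m≤n+m (suc t) s₁))

  A+B≡ : suc t + e + (s₁ + suc f) ≡ A + B
  A+B≡ = cong₂ _+_ A≡ B≡

  -- The offset o stands for X = e + 1 + o in the window [e + 1, e + m].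
  Inv : ℕ → Set
  Inv o = c (b * (suc e + o)) ≡ β

  -- Pair X with Y = q₂ - X (for X ≤ e + s₁) or Y = q₁ - X (above), and then Y with
  -- X′ = Q - Y: unless one of these splits is monochromatic, X′ has colour β again.
  -- On offsets this is the rotation o ↦ o + t + 1 mod m.
  step-below : ∀ o r → suc o + r ≡ s₁ → Inv o → Outcome ⊎ Inv (o + suc t)
  step-below o r o+r≡ inv with c (a * (suc r + f)) ≟ β
  ... | yes cY = inj₁ (inj₁ (suc e + o , suc r + f , s≤s z≤n , s≤s z≤n , XY , inv , cY))
    where
    e₁ : ∀ e o r f → suc e + o + (suc r + f) ≡ e + (suc o + r + suc f)
    e₁ = solve-∀
    XY : suc e + o + (suc r + f) ≡ q₂
    XY = trans (e₁ e o r f) (trans (cong (λ s → e + (s + suc f)) o+r≡) (trans (cong (λ x → e + x) B≡) q₂≡))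
  ... | no cY with c (b * (suc e + (o + suc t))) ≟ ρ
  ...   | yes cX′ = inj₁ (inj₂ (inj₁ (suc e + (o + suc t) , suc r + f , s≤s z≤n , s≤s z≤n ,
                                     X′Y , cX′ , ≢β⇒≡ρ cY)))
    where
    e₁ : ∀ e o t r f → suc e + (o + suc t) + (suc r + f) ≡ suc t + e + (suc o + r + suc f)
    e₁ = solve-∀
    X′Y : suc e + (o + suc t) + (suc r + f) ≡ A + B
    X′Y = trans (e₁ e o t r f) (trans (cong (λ s → suc t + e + (s + suc f)) o+r≡) A+B≡)
  ...   | no cX′ = inj₂ (≢ρ⇒≡β cX′)

  step-above : ∀ o r → o + r ≡ t → Inv (s₁ + o) → Outcome ⊎ Inv o
  step-above o r o+r≡ inv with c (a * suc (r + s₁ + f)) ≟ β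
  ... | yes cY = inj₁ (inj₂ (inj₂ (suc e + (s₁ + o) , suc (r + s₁ + f) , s≤s z≤n , s≤s z≤n ,
                                   XY , inv , cY)))
    where
    e₁ : ∀ e s₁ o r f → suc e + (s₁ + o) + suc (r + s₁ + f) ≡ suc (o + r) + e + (s₁ + suc f) + s₁
    e₁ = solve-∀
    XY : suc e + (s₁ + o) + suc (r + s₁ + f) ≡ q₁
    XY = trans (e₁ e s₁ o r f) (trans (cong (λ u → suc u + e + (s₁ + suc f) + s₁) o+r≡)
                                     (trans (cong (_+ s₁) A+B≡) q₁≡))
  ... | no cY with c (b * (suc e + o)) ≟ ρ
  ...   | yes cX′ = inj₁ (inj₂ (inj₁ (suc e + o , suc (r + s₁ + f) , s≤s z≤n , s≤s z≤n ,
                                     X′Y , cX′ , ≢β⇒≡ρ cY)))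
    where
    e₁ : ∀ e s₁ o r f → suc e + o + suc (r + s₁ + f) ≡ suc (o + r) + e + (s₁ + suc f)
    e₁ = solve-∀
    X′Y : suc e + o + suc (r + s₁ + f) ≡ A + B
    X′Y = trans (e₁ e s₁ o r f) (trans (cong (λ u → suc u + e + (s₁ + suc f)) o+r≡) A+B≡)
  ...   | no cX′ = inj₂ (≢ρ⇒≡β cX′)

  step : ∀ o → o < m → Inv o → Outcome ⊎ Inv ((o + suc t) % m)
  step o o<m inv with o <? s₁
  ... | yes o<s₁ = map₂ (subst Inv (sym (m<n⇒m%n≡m (+-monoˡ-< (suc t) o<s₁))))
                        (step-below o (s₁ ∸ suc o) (m+[n∸m]≡n o<s₁) inv)
  ... | no o≮s₁ = map₂ (subst Inv (sym wrap))
                       (step-above o′ (t ∸ o′) (m+[n∸m]≡n (≤-pred o′<suc-t)) (subst Inv (sym s₁+o′≡o) inv))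
    where
    o′ : ℕ
    o′ = o ∸ s₁
    s₁+o′≡o : s₁ + o′ ≡ o
    s₁+o′≡o = m+[n∸m]≡n (≮⇒≥ o≮s₁)
    o′<suc-t : o′ < suc t
    o′<suc-t = +-cancelˡ-< s₁ o′ (suc t) (subst (_< m) (sym s₁+o′≡o) o<m)
    e₁ : ∀ s₁ o′ t → s₁ + o′ + suc t ≡ o′ + (s₁ + suc t)
    e₁ = solve-∀
    wrap : (o + suc t) % m ≡ o′
    wrap = begin
      (o + suc t) % m         ≡⟨ cong (λ x → (x + suc t) % m) s₁+o′≡o ⟨
      (s₁ + o′ + suc t) % m   ≡⟨ cong (_% m) (e₁ s₁ o′ t) ⟩
      (o′ + m) % m            ≡⟨ [m+n]%n≡m%n o′ m ⟩
      o′ % m                  ≡⟨ m<n⇒m%n≡m (≤-trans o′<suc-t (m≤n+m (suc t) s₁)) ⟩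
      o′                      ∎
      where open ≡-Reasoning

  orbit-end : (t + (s₁ + t) * suc t) % m ≡ s₁ + t
  orbit-end = trans (cong (_% m) (e₁ s₁ t))
                    (trans ([m+kn]%n≡m%n (s₁ + t) t m) (m<n⇒m%n≡m (+-monoʳ-< s₁ (n<1+n t))))
    where
    e₁ : ∀ s₁ t → t + (s₁ + t) * suc t ≡ s₁ + t + t * (s₁ + suc t)
    e₁ = solve-∀

  B≥1 : 1 ≤ B
  B≥1 = subst (1 ≤_) B≡ (≤-trans (s≤s z≤n) (m≤n+m (suc f) s₁))

  -- Unless (A, B) is a ρ-split of Q, X = A has colour β; s₁ + t rotations carry it to
  -- the top of the window, X = A + s₁, and (A + s₁, B) is a β-split of q₁.
  outcome : Outcome
  outcome with c (b * A) ≟ ρ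
  ... | yes cA = inj₂ (inj₁ (A , B , subst (1 ≤_) A≡ (s≤s z≤n) , B≥1 , refl , cA ,
                             trans (cong c (sym bA≡aB)) cA))
  ... | no cA with iterate-rotation Inv m (suc t) step t initial (s₁ + t)
    where
    initial : Inv (t % m)
    initial = subst Inv (sym (m<n⇒m%n≡m (≤-trans (n<1+n t) (m≤n+m (suc t) s₁))))
                (subst (λ X → c (b * X) ≡ β) (trans (sym A≡) (cong suc (+-comm t e))) (≢ρ⇒≡β cA))
  ...   | inj₁ out = out
  ...   | inj₂ inv = inj₂ (inj₂ (suc e + (s₁ + t) , B , s≤s z≤n , B≥1 , XY , subst Inv orbit-end inv ,
                                 trans (cong c (sym bA≡aB)) (≢ρ⇒≡β cA)))
    where
    e₁ : ∀ e s₁ t B → suc e + (s₁ + t) + B ≡ suc t + e + B + s₁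
    e₁ = solve-∀
    XY : suc e + (s₁ + t) + B ≡ q₁
    XY = trans (e₁ e s₁ t B) (trans (cong (λ x → x + B + s₁) A≡) q₁≡)

three-targets : ∀ (c : Colouring 2) a b A B q₂ q₁ {β ρ} → β ≢ ρ → b * A ≡ a * B →
                B ≤ q₂ → q₂ < A + B → A + B < q₁ → q₁ < A + B + B →
                ThreeTargets c a b q₂ (A + B) q₁ β ρ
three-targets c a b A B q₂ q₁ β≢ρ bA≡aB B≤q₂ q₂<A+B A+B<q₁ q₁<A+B+B =
  Rotation.outcome c a b A B q₂ q₁ e t s₁ f β≢ρ bA≡aB A≡ B≡ q₂≡ q₁≡
  where
  e : ℕ
  e = q₂ ∸ B
  q₂≡ : e + B ≡ q₂
  q₂≡ = m∸n+n≡m B≤q₂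
  t : ℕ
  t = A + B ∸ suc q₂
  e₁ : ∀ t e B → suc t + e + B ≡ suc (e + B) + t
  e₁ = solve-∀
  A≡ : suc t + e ≡ A
  A≡ = +-cancelʳ-≡ B _ _ (trans (e₁ t e B) (trans (cong (λ x → suc x + t) q₂≡) (m+[n∸m]≡n q₂<A+B)))
  s₁ : ℕ
  s₁ = q₁ ∸ (A + B)
  q₁≡ : A + B + s₁ ≡ q₁
  q₁≡ = m+[n∸m]≡n (<⇒≤ A+B<q₁)
  s₁<B : s₁ < B
  s₁<B = +-cancelˡ-< (A + B) s₁ B (subst (_< A + B + B) (sym q₁≡) q₁<A+B+B)
  f : ℕ
  f = B ∸ suc s₁
  B≡ : s₁ + suc f ≡ B
  B≡ = trans (+-suc s₁ f) (m+[n∸m]≡n s₁<B)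

MonochromaticSolution : ℕ → ℕ → (ℕ → ℕ) → Colouring 2 → ℕ → Set
MonochromaticSolution a b P c N =
  ∃[ x ] ∃[ y ] ∃[ z ] (1 ≤ x × 1 ≤ y × N ≤ z × a * x + b * y ≡ P z × c x ≡ c y × c y ≡ c z)

module Main (a b : ℕ) (1≤a : 1 ≤ a) (1≤b : 1 ≤ b) (r : ℕ → ℕ) (c : Colouring 2)
            (S₀ : ℕ) (1≤S₀ : 1 ≤ S₀)
            (r-large : ∀ z → S₀ ≤ z → 2 * a * (a + b) ≤ r z)
            (r-mono  : ∀ u → S₀ ≤ u → ∀ v → u ≤ v → r u ≤ r v)
            (K₁ K₂ K₃ : ℕ)
            (slow₁ : ∀ u → S₀ ≤ u → ∀ v → u ≤ v → Close K₁ u v → Close (2 * (a + b)) (u * r u) (v * r v))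
            (slow₂ : ∀ u → S₀ ≤ u → ∀ v → u ≤ v → Close K₂ u v → Close K₁ (u * r u) (v * r v))
            (slow₃ : ∀ u → S₀ ≤ u → ∀ v → u ≤ v → Close K₃ u v → Close (2 * b) (u * r u) (v * r v))
            where

  P : ℕ → ℕ
  P z = z * r z

  Solution : Set
  Solution = MonochromaticSolution a b P c S₀

  1≤a+b : 1 ≤ a + b
  1≤a+b = ≤-trans 1≤a (m≤m+n a b)

  L : ℕ
  L = a * b * (a + b)

  instance
    a+b≢0 : NonZero (a + b)
    a+b≢0 = >-nonZero 1≤a+b
    L≢0 : NonZero L
    L≢0 = >-nonZero (*-mono-≤ (*-mono-≤ 1≤a 1≤b) 1≤a+b)

  a+b≤r : ∀ z → S₀ ≤ z → a + b ≤ r z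
  a+b≤r z S₀≤z =
    ≤-trans (m≤n*m (a + b) (2 * a) {{>-nonZero (*-mono-≤ {1} {2} (s≤s z≤n) 1≤a)}}) (r-large z S₀≤z)

  1≤r : ∀ z → S₀ ≤ z → 1 ≤ r z
  1≤r z S₀≤z = ≤-trans 1≤a+b (a+b≤r z S₀≤z)

  z≤P : ∀ z → S₀ ≤ z → z ≤ P z
  z≤P z S₀≤z = m≤m*n z (r z) {{>-nonZero (1≤r z S₀≤z)}}

  1≤P : ∀ z → S₀ ≤ z → 1 ≤ P z
  1≤P z S₀≤z = ≤-trans 1≤S₀ (≤-trans S₀≤z (z≤P z S₀≤z))

  P-strictMono : ∀ {u v} → S₀ ≤ u → u < v → P u < P v
  P-strictMono {u} {v} S₀≤u u<v =
    <-≤-trans (*-monoˡ-< (r u) {{>-nonZero (1≤r u S₀≤u)}} u<v) (*-monoʳ-≤ v (r-mono u S₀≤u v (<⇒≤ u<v)))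

  solution : ∀ {x y z} → 1 ≤ x → 1 ≤ y → S₀ ≤ z → a * x + b * y ≡ P z → c x ≡ c z → c y ≡ c z →
             Solution
  solution {x} {y} {z} 1≤x 1≤y S₀≤z eq cx cy = x , y , z , 1≤x , 1≤y , S₀≤z , eq , trans cx (sym cy) , cy

  diagonal-solution : ∀ {w z} → S₀ ≤ z → (a + b) * w ≡ P z → c w ≡ c z → Solution
  diagonal-solution {w} {z} S₀≤z eq cw = solution 1≤w 1≤w S₀≤z (trans (sym (*-distribʳ-+ w a b)) eq) cw cw
    where
    1≤w : 1 ≤ w
    1≤w = >-nonZero⁻¹ w {{m*n≢0⇒n≢0 (a + b) {{>-nonZero (subst (1 ≤_) (sym eq) (1≤P z S₀≤z))}}}}

  split-solution : ∀ {Z Q γ} → S₀ ≤ Z → a * b * Q ≡ P Z → c Z ≡ γ → MonoSplit c a b Q γ → Solution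
  split-solution S₀≤Z eq cZ (X , Y , 1≤X , 1≤Y , X+Y≡Q , cX , cY) =
    solution (*-mono-≤ 1≤b 1≤X) (*-mono-≤ 1≤a 1≤Y) S₀≤Z
             (trans (e a b X Y) (trans (cong (a * b *_) X+Y≡Q) eq)) (trans cX (sym cZ)) (trans cY (sym cZ))
    where
    e : ∀ a b X Y → a * (b * X) + b * (a * Y) ≡ a * b * (X + Y)
    e = solve-∀

  κ : ℕ → ℕ
  κ u = u * r (L * u)

  P-multiple : ∀ u → P (L * u) ≡ L * κ u
  P-multiple u = *-assoc L u (r (L * u))

  scaled-P-multiple : ∀ m u → m * P (L * u) ≡ L * (m * κ u)
  scaled-P-multiple m u = trans (cong (m *_) (P-multiple u)) (e m L (κ u))
    where
    e : ∀ m L k → m * (L * k) ≡ L * (m * k)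
    e = solve-∀

  cancel-L-≤ : ∀ m n u v → m * P (L * u) ≤ n * P (L * v) → m * κ u ≤ n * κ v
  cancel-L-≤ m n u v le = *-cancelˡ-≤ L (subst₂ _≤_ (scaled-P-multiple m u) (scaled-P-multiple n v) le)

  cancel-L-< : ∀ m n u v → m * P (L * u) < n * P (L * v) → m * κ u < n * κ v
  cancel-L-< m n u v lt = *-cancelˡ-< L _ _ (subst₂ _<_ (scaled-P-multiple m u) (scaled-P-multiple n v) lt)

  three-points : ∀ u₂ u u₁ → S₀ ≤ L * u₂ → S₀ ≤ L * u → S₀ ≤ L * u₁ →
                 c (L * u₂) ≡ c (L * u₁) → c (L * u₁) ≢ c (L * u) →
                 b * P (L * u) ≤ (a + b) * P (L * u₂) → P (L * u₂) < P (L * u) → P (L * u) < P (L * u₁) →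
                 (a + b) * P (L * u₁) < (a + b + b) * P (L * u) → Solution
  three-points u₂ u u₁ S₀≤Z₂ S₀≤Z S₀≤Z₁ c₂≡c₁ c₁≢c b-bound P₂<P P<P₁ ratio =
    [ from-target S₀≤Z₂ c₂≡c₁ (sym (*-assoc (a * b) (a + b) (κ u₂))) ,
    [ from-target S₀≤Z refl (e₃ a b (κ u)) ,
      from-target S₀≤Z₁ refl (sym (*-assoc (a * b) (a + b) (κ u₁))) ]′ ]′
      (three-targets c a b (a * κ u) (b * κ u) ((a + b) * κ u₂) ((a + b) * κ u₁) c₁≢c (e₁ a b (κ u))
         (cancel-L-≤ b (a + b) u u₂ b-bound)
         (subst ((a + b) * κ u₂ <_) (*-distribʳ-+ (κ u) a b)
                (cancel-L-< (a + b) (a + b) u₂ u (*-monoʳ-< (a + b) P₂<P)))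
         (subst (_< (a + b) * κ u₁) (*-distribʳ-+ (κ u) a b)
                (cancel-L-< (a + b) (a + b) u u₁ (*-monoʳ-< (a + b) P<P₁)))
         (subst ((a + b) * κ u₁ <_) (e₂ a b (κ u)) (cancel-L-< (a + b) (a + b + b) u₁ u ratio)))
    where
    e₁ : ∀ a b k → b * (a * k) ≡ a * (b * k)
    e₁ = solve-∀
    e₂ : ∀ a b k → (a + b + b) * k ≡ a * k + b * k + b * k
    e₂ = solve-∀
    e₃ : ∀ a b k → a * b * (a * k + b * k) ≡ a * b * (a + b) * k
    e₃ = solve-∀
    from-target : ∀ {v Q γ} → S₀ ≤ L * v → c (L * v) ≡ γ → a * b * Q ≡ L * κ v →
                  MonoSplit c a b Q γ → Solution
    from-target {v} S₀≤Z cZ eq = split-solution S₀≤Z (trans eq (sym (P-multiple v))) cZ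

  close-ratio< : ∀ X Y → 1 ≤ Y → Close (2 * (a + b)) Y X → (a + b) * X < (a + b + b) * Y
  close-ratio< X Y 1≤Y close = *-cancelˡ-< 2 _ _
    (≤-<-trans (subst (_≤ suc (2 * (a + b)) * Y) (*-assoc 2 (a + b) X) close)
               (subst (suc (2 * (a + b)) * Y <_) (sym (e a b Y)) (+-monoˡ-< (2 * (a + b) * Y) Y<2bY)))
    where
    e : ∀ a b Y → 2 * ((a + b + b) * Y) ≡ 2 * (b * Y) + 2 * (a + b) * Y
    e = solve-∀
    Y<2bY : Y < 2 * (b * Y)
    Y<2bY = <-≤-trans (m<m+n Y 1≤Y)
      (subst (Y + Y ≤_) (cong (λ x → b * Y + x) (sym (+-identityʳ (b * Y))))
             (+-mono-≤ (m≤n*m Y b {{>-nonZero 1≤b}}) (m≤n*m Y b {{>-nonZero 1≤b}})))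

  close-ratio≤ : ∀ X Y → Close (2 * (a + b)) Y X → b * X ≤ (a + b) * Y
  close-ratio≤ X Y close = *-cancelˡ-≤ (2 * (a + b)) {{>-nonZero (≤-trans 1≤a+b (m≤m+n (a + b) _))}}
    (subst₂ _≤_ (e₁ a b X) (e₂ a b Y)
      (≤-trans (subst (b * (2 * (a + b) * X) ≤_) (sym (*-assoc b (suc (2 * (a + b))) Y))
                      (*-monoʳ-≤ b close))
               (*-monoˡ-≤ Y coefficient)))
    where
    e₁ : ∀ a b X → b * (2 * (a + b) * X) ≡ 2 * (a + b) * (b * X)
    e₁ = solve-∀
    e₂ : ∀ a b Y → (2 * (a + b) * (a + b)) * Y ≡ 2 * (a + b) * ((a + b) * Y)
    e₂ = solve-∀
    e₃ : ∀ a b → b * suc (2 * (a + b)) ≡ b + 2 * (a + b) * b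
    e₃ = solve-∀
    e₄ : ∀ a b → 2 * (a + b) * a + 2 * (a + b) * b ≡ 2 * (a + b) * (a + b)
    e₄ = solve-∀
    b≤ : b ≤ 2 * (a + b) * a
    b≤ = ≤-trans (m≤n+m b a) (≤-trans (m≤m+n (a + b) _) (m≤m*n (2 * (a + b)) a {{>-nonZero 1≤a}}))
    coefficient : b * suc (2 * (a + b)) ≤ 2 * (a + b) * (a + b)
    coefficient = subst₂ _≤_ (sym (e₃ a b)) (e₄ a b) (+-monoˡ-≤ (2 * (a + b) * b) b≤)

  -- Grid points are multiples of L, as three-points needs, and of b (a + b), which
  -- makes the diagonal partner (a + b)⁻¹ P (G j) an integer.
  H : ℕ
  H = L * (b * (a + b))

  instance
    b[a+b]≢0 : NonZero (b * (a + b))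
    b[a+b]≢0 = >-nonZero (*-mono-≤ 1≤b 1≤a+b)
    H≢0 : NonZero H
    H≢0 = m*n≢0 L (b * (a + b))

  G : ℕ → ℕ
  G j = L * (b * (a + b) * j)

  H*j≡G : ∀ j → H * j ≡ G j
  H*j≡G j = e L b (a + b) j
    where
    e : ∀ L b s j → L * (b * s) * j ≡ L * (b * s * j)
    e = solve-∀

  G-suc : ∀ j → G (suc j) ≡ G j + H
  G-suc j = begin
    G (suc j)   ≡⟨ H*j≡G (suc j) ⟨
    H * suc j   ≡⟨ *-suc H j ⟩
    H + H * j   ≡⟨ +-comm H (H * j) ⟩
    H * j + H   ≡⟨ cong (_+ H) (H*j≡G j) ⟩
    G j + H     ∎
    where open ≡-Reasoning

  G-strictMono : ∀ {i j} → i < j → G i < G j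
  G-strictMono i<j = *-monoʳ-< L (*-monoʳ-< (b * (a + b)) i<j)

  j≤G : ∀ j → j ≤ G j
  j≤G j = subst (j ≤_) (H*j≡G j) (m≤n*m j H)

  σ : ℕ
  σ = suc (S₀ + (K₁ + (K₂ + K₃)))

  -- The factor a + b gives (a + b) G (σ r (G j₀)) = P (G j₀), see G-jW.
  j₀ : ℕ
  j₀ = (a + b) * σ

  σ≤j₀ : σ ≤ j₀
  σ≤j₀ = m≤n*m σ (a + b)

  S₀≤G : ∀ {j} → j₀ ≤ j → S₀ ≤ G j
  S₀≤G {j} j₀≤j = ≤-trans (≤-trans (m≤m+n S₀ _) (≤-trans (n≤1+n _) (≤-trans σ≤j₀ j₀≤j))) (j≤G j)

  K₁≤σ : K₁ ≤ σ
  K₁≤σ = ≤-trans (m≤m+n K₁ _) (≤-trans (m≤n+m _ S₀) (n≤1+n _))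

  K₂≤σ : K₂ ≤ σ
  K₂≤σ = ≤-trans (m≤m+n K₂ K₃) (≤-trans (m≤n+m _ K₁) (≤-trans (m≤n+m _ S₀) (n≤1+n _)))

  K₃≤σ : K₃ ≤ σ
  K₃≤σ = ≤-trans (m≤n+m K₃ K₂) (≤-trans (m≤n+m _ K₁) (≤-trans (m≤n+m _ S₀) (n≤1+n _)))

  -- Consecutive grid points differ by H, which is small compared with G j once j ≥ K.
  G-close : ∀ {K j} → K ≤ σ → j₀ ≤ j → Close K (G j) (G (suc j))
  G-close {K} {j} K≤σ j₀≤j = subst (λ Z → K * Z ≤ suc K * G j) (sym (G-suc j))
    (subst₂ _≤_ (sym (*-distribˡ-+ K (G j) H)) (+-comm (K * G j) (G j)) (+-monoʳ-≤ (K * G j) KH≤G))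
    where
    KH≤G : K * H ≤ G j
    KH≤G = subst (K * H ≤_) (trans (*-comm j H) (H*j≡G j))
                 (*-monoˡ-≤ H (≤-trans K≤σ (≤-trans σ≤j₀ j₀≤j)))

  grid-ratio : ∀ {j} → j₀ ≤ j → (a + b) * P (G (suc j)) < (a + b + b) * P (G j)
  grid-ratio {j} j₀≤j = close-ratio< (P (G (suc j))) (P (G j)) (1≤P (G j) (S₀≤G j₀≤j))
    (slow₁ (G j) (S₀≤G j₀≤j) (G (suc j)) (<⇒≤ (G-strictMono (n<1+n j))) (G-close K₁≤σ j₀≤j))

  diagonal : ℕ → ℕ
  diagonal j = L * (b * j * r (G j))

  diagonal-eq : ∀ j → (a + b) * diagonal j ≡ P (G j)
  diagonal-eq j = e a b j (r (G j))
    where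
    e : ∀ a b j r → (a + b) * (a * b * (a + b) * (b * j * r)) ≡ a * b * (a + b) * (b * (a + b) * j) * r
    e = solve-∀

  G≤diagonal : ∀ {j} → j₀ ≤ j → G j ≤ diagonal j
  G≤diagonal {j} j₀≤j = *-cancelˡ-≤ (a + b)
    (subst₂ _≤_ (*-comm (G j) (a + b)) (sym (diagonal-eq j)) (*-monoʳ-≤ (G j) (a+b≤r (G j) (S₀≤G j₀≤j))))

  short-run : ∀ {jv j} → j₀ ≤ jv → jv < j → c (G j) ≢ c (G jv) → c (G (suc j)) ≡ c (G jv) →
              b * P (G j) ≤ (a + b) * P (G jv) → Solution
  short-run {jv} {j} j₀≤jv jv<j cj≢cjv csj≡cjv bound =
    three-points (b * (a + b) * jv) (b * (a + b) * j) (b * (a + b) * suc j)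
      (S₀≤G j₀≤jv) (S₀≤G j₀≤j) (S₀≤G (≤-trans j₀≤j (n≤1+n j)))
      (sym csj≡cjv) (λ e → cj≢cjv (trans (sym e) csj≡cjv)) bound
      (P-strictMono (S₀≤G j₀≤jv) (G-strictMono jv<j))
      (P-strictMono (S₀≤G j₀≤j) (G-strictMono (n<1+n j)))
      (grid-ratio j₀≤j)
    where
    j₀≤j : j₀ ≤ j
    j₀≤j = ≤-trans j₀≤jv (<⇒≤ jv<j)

  -- After a change at jv follow the run of grid points of colour β = c (G J). If it ends
  -- while W stays below y, short-run applies; otherwise W k ≤ y < W (suc k) inside the run.
  module AfterChange (jv : ℕ) (j₀≤jv : j₀ ≤ jv) (change : c (G (suc jv)) ≢ c (G jv)) where

    J : ℕ
    J = suc jv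

    V : ℕ
    V = G jv

    S₀≤V : S₀ ≤ V
    S₀≤V = S₀≤G j₀≤jv

    j₀≤k+J : ∀ k → j₀ ≤ k + J
    j₀≤k+J k = ≤-trans j₀≤jv (≤-trans (n≤1+n jv) (m≤n+m J k))

    y : ℕ
    y = L * ((a + b) * jv * (r V ∸ a))

    y-solves : a * V + b * y ≡ P V
    y-solves = trans (e a b jv (r V ∸ a))
                     (cong (V *_) (m+[n∸m]≡n (≤-trans (m≤m+n a b) (a+b≤r V S₀≤V))))
      where
      e : ∀ a b jv d → a * (a * b * (a + b) * (b * (a + b) * jv))
                       + b * (a * b * (a + b) * ((a + b) * jv * d))
                       ≡ a * b * (a + b) * (b * (a + b) * jv) * (a + d)
      e = solve-∀

    PV-split : (a + b) * P V ≡ a * (a + b) * V + b * (a + b) * y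
    PV-split = trans (cong ((a + b) *_) (sym y-solves)) (e a b V y)
      where
      e : ∀ a b V y → (a + b) * (a * V + b * y) ≡ a * (a + b) * V + b * (a + b) * y
      e = solve-∀

    W : ℕ → ℕ
    W k = diagonal (k + J)

    b[a+b]W : ∀ k → b * (a + b) * W k ≡ b * P (G (k + J))
    b[a+b]W k = trans (*-assoc b (a + b) (W k)) (cong (b *_) (diagonal-eq (k + J)))

    W0≤y : W 0 ≤ y
    W0≤y = *-cancelˡ-≤ (b * (a + b)) (subst (_≤ b * (a + b) * y) (sym (b[a+b]W 0)) bX≤)
      where
      X : ℕ
      X = P (G J)
      slow : 2 * b * X ≤ suc (2 * b) * P V
      slow = slow₃ V S₀≤V (G J) (<⇒≤ (G-strictMono (n<1+n jv))) (G-close K₃≤σ j₀≤jv)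
      large : 2 * a * (a + b) * V ≤ P V
      large = subst (2 * a * (a + b) * V ≤_) (*-comm (r V) V) (*-monoˡ-≤ V (r-large V S₀≤V))
      e₁ : ∀ a b X V → 2 * (b * X + a * (a + b) * V) ≡ 2 * b * X + 2 * a * (a + b) * V
      e₁ = solve-∀
      e₂ : ∀ b PV → suc (2 * b) * PV + PV ≡ 2 * (suc b * PV)
      e₂ = solve-∀
      sum : b * X + a * (a + b) * V ≤ (a + b) * P V
      sum = *-cancelˡ-≤ 2 (subst (_≤ 2 * ((a + b) * P V)) (sym (e₁ a b X V))
              (≤-trans (+-mono-≤ slow large)
                (≤-trans (≤-reflexive (e₂ b (P V))) (*-monoʳ-≤ 2 (*-monoˡ-≤ (P V) (+-monoˡ-≤ b 1≤a))))))
      bX≤ : b * X ≤ b * (a + b) * y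
      bX≤ = +-cancelˡ-≤ (a * (a + b) * V) _ _ (subst₂ _≤_ (+-comm (b * X) _) PV-split sum)

    y<W-y : y < W y
    y<W-y = <-≤-trans (m<m+n y (s≤s z≤n)) (≤-trans (j≤G (y + J)) (G≤diagonal (j₀≤k+J y)))

    short-bound : ∀ k → W k ≤ y → b * P (G (k + J)) ≤ (a + b) * P V
    short-bound k W≤y = subst₂ _≤_ (b[a+b]W k) (sym PV-split)
                           (≤-trans (*-monoʳ-≤ (b * (a + b)) W≤y) (m≤n+m _ _))

    -- Unless (V, y, V) or the diagonal solution at W k or W (suc k) is monochromatic,
    -- W k < y < W (suc k) have colours ρ, β, ρ and three-points applies.
    solution-near : ∀ k → c (G (k + J)) ≡ c (G J) → c (G (suc k + J)) ≡ c (G J) →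
                    W k ≤ y → y < W (suc k) → Solution
    solution-near k cZ cZ′ w₁≤y y<w₂ with c y ≟ c V
    ... | yes cy = solution (≤-trans 1≤S₀ S₀≤V) (≤-trans 1≤S₀ S₀≤y) S₀≤V y-solves refl cy
      where
      S₀≤y : S₀ ≤ y
      S₀≤y = ≤-trans (S₀≤G (j₀≤k+J k)) (≤-trans (G≤diagonal (j₀≤k+J k)) w₁≤y)
    ... | no cy with c (W k) ≟ c (G J)
    ...   | yes cw₁ = diagonal-solution (S₀≤G (j₀≤k+J k)) (diagonal-eq (k + J)) (trans cw₁ (sym cZ))
    ...   | no cw₁ with c (W (suc k)) ≟ c (G J)
    ...     | yes cw₂ =
      diagonal-solution (S₀≤G (j₀≤k+J (suc k))) (diagonal-eq (suc k + J)) (trans cw₂ (sym cZ′))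
    ...     | no cw₂ =
      three-points _ _ _ S₀≤w₁ S₀≤y S₀≤w₂ (trans cw₁≡ρ (sym cw₂≡ρ))
        (λ e → change (trans (sym cy≡β) (trans (sym e) cw₂≡ρ)))
        (≤-trans (*-monoʳ-≤ b (<⇒≤ Py<Pw₂)) (close-ratio≤ (P w₂) (P w₁) close))
        Pw₁<Py Py<Pw₂
        (<-≤-trans (close-ratio< (P w₂) (P w₁) (1≤P w₁ S₀≤w₁) close) (*-monoʳ-≤ (a + b + b) (<⇒≤ Pw₁<Py)))
      where
      w₁ w₂ : ℕ
      w₁ = W k
      w₂ = W (suc k)
      cy≡β : c y ≡ c (G J)
      cy≡β = x≢z∧y≢z⇒x≡y cy change
      cw₁≡ρ : c w₁ ≡ c V
      cw₁≡ρ = x≢z∧y≢z⇒x≡y cw₁ (λ e → change (sym e))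
      cw₂≡ρ : c w₂ ≡ c V
      cw₂≡ρ = x≢z∧y≢z⇒x≡y cw₂ (λ e → change (sym e))
      S₀≤Z : S₀ ≤ G (k + J)
      S₀≤Z = S₀≤G (j₀≤k+J k)
      S₀≤w₁ : S₀ ≤ w₁
      S₀≤w₁ = ≤-trans S₀≤Z (G≤diagonal (j₀≤k+J k))
      S₀≤y : S₀ ≤ y
      S₀≤y = ≤-trans S₀≤w₁ w₁≤y
      S₀≤w₂ : S₀ ≤ w₂
      S₀≤w₂ = ≤-trans S₀≤y (<⇒≤ y<w₂)
      w₁<y : w₁ < y
      w₁<y = ≤∧≢⇒< w₁≤y (λ e → change (trans (sym cy≡β) (trans (cong c (sym e)) cw₁≡ρ)))
      Pw₁<Py : P w₁ < P y
      Pw₁<Py = P-strictMono S₀≤w₁ w₁<y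
      Py<Pw₂ : P y < P w₂
      Py<Pw₂ = P-strictMono S₀≤y y<w₂
      close : Close (2 * (a + b)) (P w₁) (P w₂)
      close = slow₁ w₁ S₀≤w₁ w₂ (≤-trans w₁≤y (<⇒≤ y<w₂))
        (Close-*-cancelˡ {K₁} {w₁} {w₂} (a + b)
          (subst₂ (Close K₁) (sym (diagonal-eq (k + J))) (sym (diagonal-eq (suc k + J)))
          (slow₂ (G (k + J)) S₀≤Z (G (suc k + J)) (<⇒≤ (G-strictMono (n<1+n (k + J))))
                 (G-close K₂≤σ (j₀≤k+J k)))))

    long-run : ∀ i → ConstantUpTo (λ k → c (G (k + J))) i → y < W i → Solution
    long-run i run y<Wi =
      let k , k<i , w₁≤y , y<w₂ = bracket W i W0≤y y<Wi
      in solution-near k (run k (<⇒≤ k<i)) (run (suc k) k<i) w₁≤y y<w₂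

    solution-after-change : Solution
    solution-after-change =
      [ (λ (i , run , y<Wi) → long-run i run y<Wi) ,
        (λ (i , run , y≮Wi , end) →
           short-run j₀≤jv (<-≤-trans (n<1+n jv) (m≤n+m J i)) (λ e → change (trans (sym (run i ≤-refl)) e))
             (x≢z∧y≢z⇒x≡y end (λ e → change (sym e))) (short-bound i (≮⇒≥ y≮Wi))) ]′
      (run-until (λ k → c (G (k + J))) (λ k → y <? W k) y y<W-y)

  jW : ℕ
  jW = σ * r (G j₀)

  j₀≤jW : j₀ ≤ jW
  j₀≤jW = subst (_≤ jW) (*-comm σ (a + b)) (*-monoʳ-≤ σ (a+b≤r (G j₀) (S₀≤G ≤-refl)))

  G-jW : (a + b) * G jW ≡ P (G j₀)
  G-jW = e a b σ (r (G j₀))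
    where
    e : ∀ a b σ r → (a + b) * (a * b * (a + b) * (b * (a + b) * (σ * r)))
                    ≡ a * b * (a + b) * (b * (a + b) * ((a + b) * σ)) * r
    e = solve-∀

  -- Either the grid is monochromatic from j₀ up to jW, giving the diagonal solution
  -- (G jW, G jW, G j₀), or it changes colour somewhere in between.
  solution-exists : Solution
  solution-exists with run-until (λ i → c (G (i + j₀))) (λ i → jW ∸ j₀ ≤? i) (jW ∸ j₀) ≤-refl
  ... | inj₁ (i , run , n≤i) =
    diagonal-solution (S₀≤G ≤-refl) G-jW
      (subst (λ j → c (G j) ≡ c (G j₀)) (m∸n+n≡m j₀≤jW) (run (jW ∸ j₀) n≤i))
  ... | inj₂ (i , run , _ , end) =
    AfterChange.solution-after-change (i + j₀) (m≤n+m j₀ i) (λ e → end (trans e (run i ≤-refl)))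

MonochromaticSolution-weaken : ∀ {a b P c M N} → N ≤ M →
                               MonochromaticSolution a b P c M → MonochromaticSolution a b P c N
MonochromaticSolution-weaken N≤M (x , y , z , 1≤x , 1≤y , M≤z , rest) =
  x , y , z , 1≤x , 1≤y , ≤-trans N≤M M≤z , rest

monochromatic-solutions : ∀ a b → 1 ≤ a → 1 ≤ b → ∀ {r} → Regular r → Unbounded r →
                          ∀ (c : Colouring 2) N → MonochromaticSolution a b (λ z → z * r z) c N
monochromatic-solutions a b 1≤a 1≤b {r} R U c N =
  let K₁ , slow₁ = slowlyVarying (*-regular R) (2 * (a + b))
      K₂ , slow₂ = slowlyVarying (*-regular R) K₁
      K₃ , slow₃ = slowlyVarying (*-regular R) (2 * b)
      S , facts = eventually-× (U (2 * a * (a + b)))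
                    (eventually-× (monotone R) (eventually-× slow₁ (eventually-× slow₂ slow₃)))
      S≤ : ∀ {z} → suc N ⊔ S ≤ z → S ≤ z
      S≤ = m⊔n≤o⇒n≤o (suc N) S
  in MonochromaticSolution-weaken {a} {b} (≤-trans (n≤1+n N) (m≤m⊔n (suc N) S))
       (Main.solution-exists a b 1≤a 1≤b r c (suc N ⊔ S) (≤-trans (s≤s z≤n) (m≤m⊔n (suc N) S))
          (λ z h → proj₁ (facts z (S≤ h)))
          (λ z h → proj₁ (proj₂ (facts z (S≤ h))))
          K₁ K₂ K₃
          (λ z h → proj₁ (proj₂ (proj₂ (facts z (S≤ h)))))
          (λ z h → proj₁ (proj₂ (proj₂ (proj₂ (facts z (S≤ h))))))
          (λ z h → proj₂ (proj₂ (proj₂ (proj₂ (facts z (S≤ h)))))))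

KRamsey-from-solution : ∀ {a b : ℕ} {cs : List ℤ} {r : ℕ → ℕ} {c : Colouring 2} {N S : ℕ} →
  (∀ z → S ≤ z → eval cs (+ z) ≡ + z *ℤ + r z) →
  MonochromaticSolution a b (λ z → z * r z) c (suc N ⊔ S) →
  ∃[ x ] ∃[ y ] ∃[ z ] IsSolution a b cs x y z × (N < x + y + z) × (c x ≡ c y) × (c y ≡ c z)
KRamsey-from-solution {a} {b} {cs} {r} {N = N} {S} eval≡
                      (x , y , z , 1≤x , 1≤y , bound , eq , cx≡cy , cy≡cz) =
  x , y , z , (1≤x , 1≤y , ≤-trans (s≤s z≤n) N<z , solves) , ≤-trans N<z (m≤n+m z (x + y)) , cx≡cy , cy≡cz
  where
  N<z : N < z
  N<z = m⊔n≤o⇒m≤o (suc N) S bound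
  solves : + a *ℤ + x +ℤ + b *ℤ + y ≡ eval cs (+ z)
  solves = begin
    + a *ℤ + x +ℤ + b *ℤ + y    ≡⟨ cong₂ _+ℤ_ (ℤ.pos-* a x) (ℤ.pos-* b y) ⟨
    + (a * x + b * y)           ≡⟨ cong +_ eq ⟩
    + (z * r z)                 ≡⟨ ℤ.pos-* z (r z) ⟩
    + z *ℤ + r z                ≡⟨ eval≡ z (m⊔n≤o⇒n≤o (suc N) S bound) ⟨
    eval cs (+ z)               ∎
    where open ≡-Reasoning

theorem1p1 : (a b : ℕ) → 0 < a → 0 < b → gcd a b ≡ 1 →
    (a₁ : ℤ) (cs : List ℤ) (a_D : ℤ) →
    2 ≤ length (a₁ ∷ cs) → last (a₁ ∷ cs) ≡ just a_D → + 0 <ℤ a_D → a₁ ≢ + 0 →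
    KRamsey 2 a b (a₁ ∷ cs)
theorem1p1 a b 0<a 0<b _ a₁ [] a_D (s≤s ()) _ _ _
theorem1p1 a b 0<a 0<b _ a₁ (d ∷ ds) a_D _ last≡a_D 0<a_D _ c N =
  let r , R , U , S , eval≡r =
        +ℤ-eventuallyRegularUnbounded a₁ (eval-eventuallyRegularUnbounded (d ∷ ds) last≡a_D 0<a_D)
  in KRamsey-from-solution {a} {b} {a₁ ∷ d ∷ ds} {r} (λ z S≤z → cong (+ z *ℤ_) (eval≡r z S≤z))
                                                  (monochromatic-solutions a b 0<a 0<b R U c (suc N ⊔ S))
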